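{- For every integer $k\ge 2$, $b_{k,2}=\frac{k}{2}$.
   Context: Let $H_{n,k}=\{0,1,\dots,n-1\}^k$. A $2$-rook is a point $P\in H_{n,k}$ together with a set $D$ of $2$ of the $k$ coordinate indices; it attacks every point of $H_{n,k}$ which differs from $P$ in exactly one coordinate, that coordinate belonging to $D$. Distinct rooks must occupy distinct points. $b_{n,k,2}$ is the maximum number of $2$-rooks that can be placed in $H_{n,k}$ so that no rook attacks the position of another rook, and $b_{k,2}=\lim_{n\to\infty} b_{n,k,2}/n^{k-1}$ (this limit exists). -}

module Defs where

open import Data.Nat using (ℕ; suc; _≤_; _^_; _∸_)
open import Data.Nat.Properties using (m^n≢0)
open import Data.Fin using (Fin; _<_)
open import Data.Vec using (Vec; lookup)
open import Data.List using (List; length)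
import Data.List as L
open import Data.Product using (Σ; ∃; _×_; _,_; proj₁)
open import Data.Sum using (_⊎_)
open import Data.Integer using (+_)
open import Data.Rational using (ℚ; _/_)
open import Relation.Binary.PropositionalEquality using (_≡_; _≢_)
open import Relation.Nullary using (¬_)

Point : ℕ → ℕ → Set
Point n k = Vec (Fin n) k

TwoSet : ℕ → Set
TwoSet k = Σ (Fin k × Fin k) (λ p → proj₁ p < Data.Product.proj₂ p)

_∈D_ : ∀ {k} → Fin k → TwoSet k → Set
c ∈D ((i , j) , _) = c ≡ i ⊎ c ≡ j

-- A 2-rook: position together with its set D of two directions
Rook : ℕ → ℕ → Set
Rook n k = Point n k × TwoSet k

pos : ∀ {n k} → Rook n k → Point n k
pos = proj₁

Attacks : ∀ {n k} → Rook n k → Point n k → Set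
Attacks {k = k} (P , D) Q =
  ∃ λ (c : Fin k) → c ∈D D × lookup P c ≢ lookup Q c
                   × (∀ (c' : Fin k) → c' ≢ c → lookup P c' ≡ lookup Q c')

Valid : ∀ {n k} → List (Rook n k) → Set
Valid rs = ∀ (a b : Fin (length rs)) → a ≢ b →
  (pos (L.lookup rs a) ≢ pos (L.lookup rs b))
  × ¬ Attacks (L.lookup rs a) (pos (L.lookup rs b))

IsMaxRooks : ℕ → ℕ → ℕ → Set
IsMaxRooks n k m =
  (∃ λ (rs : List (Rook n k)) → Valid rs × length rs ≡ m)
  × (∀ (rs : List (Rook n k)) → Valid rs → length rs ≤ m)

-- b / n^(k-1) as a rational, for n = suc n'
ratio : ℕ → ℕ → ℕ → ℚ
ratio b n' k = _/_ (+ b) (suc n' ^ (k ∸ 1)) {{m^n≢0 (suc n') (k ∸ 1)}}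

-- A rook attacks along two of the k axes, so it covers two of the k·n^(k-1)
-- axis-parallel lines of H_{n,k}; in a valid placement no line is covered twice,
-- hence 2·b_{n,k,2} ≤ k·n^(k-1).  Conversely, put a rook on every point whose
-- largest coordinate is attained exactly twice, attacking along those two axes.
-- Moving such a point along one of the two axes leaves a point whose maximum is
-- attained only once, so no rook attacks another.  These points number
-- C(k,2)·Σ_{m<n} m^(k-2) ≥ (k/2)·n^(k-1) − C(k,2)·n^(k-2), so b_{n,k,2}/n^(k-1)
-- lies within (k-1)k/(2n) of k/2.

module Submission where

open import Defs
open import Data.Nat as ℕ using (ℕ; zero; suc; _+_; _*_; _^_; _∸_; _≤_; z≤n; s≤s; z<s; s<s)
import Data.Nat.Properties as ℕ
open import Data.Nat.Tactic.RingSolver using (solve-∀)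
open import Data.Integer as ℤ using (+_; +<+; _⊖_)
import Data.Integer.Properties as ℤ
open import Data.Rational using (ℚ; mkℚ; _/_; _<_; _-_; ∣_∣; 0ℚ; *<*; toℚᵘ; ↧ₙ_)
import Data.Rational.Properties as ℚ
open import Data.Rational.Unnormalised as ℚᵘ using (mkℚᵘ; _≃_)
import Data.Rational.Unnormalised.Properties as ℚᵘ
open import Data.Fin as Fin using (Fin; zero; suc; toℕ; combine; remQuot; funToFin; finToFun)
open import Data.Fin.Properties as Fin
  using (combine-injective; combine-remQuot; finToFun-funToFin; injective⇒≤; toℕ-injective;
         toℕ-fromℕ<; toℕ-inject≤; inject≤-injective; toℕ<n)
open import Data.Vec using (Vec; []; _∷_; lookup; removeAt)
open import Data.Vec.Properties
  using (removeAt-punchOut; tabulate∘lookup; tabulate-cong; ∷-injective; ∷-injectiveˡ; ∷-injectiveʳ)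
open import Data.List as List using (List; []; _∷_; _++_; length; map; cartesianProductWith; allFin)
open import Data.List.Properties using (length-++; length-map; length-tabulate; map-++; map-∘; map-id; map-cong)
open import Data.List.Membership.Propositional using (_∈_; _∉_)
open import Data.List.Membership.Propositional.Properties
  using (∈-lookup; ∈-map⁺; ∈-map⁻; ∈-++⁻; ∈-cartesianProductWith⁻)
open import Data.List.Relation.Unary.All as All using (All)
open import Data.List.Relation.Unary.AllPairs using ([]; _∷_)
open import Data.List.Relation.Unary.Unique.Propositional using (Unique)
import Data.List.Relation.Unary.Unique.Propositional.Properties as Unique
open import Data.Product using (∃; _×_; _,_; proj₁; proj₂; uncurry)
open import Data.Product.Properties using (,-injectiveˡ; ,-injectiveʳ)
open import Data.Sum using (inj₁; inj₂)
open import Function using (_∘_; case_of_)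
open import Relation.Binary.Definitions using (tri<; tri≈; tri>)
open import Relation.Binary.PropositionalEquality
open import Relation.Nullary using (¬_; yes; no; contradiction)

lookup-ext : ∀ {A : Set} {k} (xs ys : Vec A k) → (∀ i → lookup xs i ≡ lookup ys i) → xs ≡ ys
lookup-ext xs ys eq = trans (sym (tabulate∘lookup xs)) (trans (tabulate-cong eq) (tabulate∘lookup ys))

removeAt-≡⇒lookup-≡ : ∀ {A : Set} {k} (xs ys : Vec A (suc k)) {c} → removeAt xs c ≡ removeAt ys c →
  ∀ l → l ≢ c → lookup xs l ≡ lookup ys l
removeAt-≡⇒lookup-≡ xs ys {c} eq l l≢c = begin
  lookup xs l                                     ≡⟨ removeAt-punchOut xs c≢l ⟨
  lookup (removeAt xs c) (Fin.punchOut c≢l)       ≡⟨ cong (λ v → lookup v (Fin.punchOut c≢l)) eq ⟩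
  lookup (removeAt ys c) (Fin.punchOut c≢l)       ≡⟨ removeAt-punchOut ys c≢l ⟩
  lookup ys l                                     ∎
  where
  open ≡-Reasoning
  c≢l : c ≢ l
  c≢l = l≢c ∘ sym

Unique-map⇒lookup-injective : ∀ {A B : Set} (f : A → B) (xs : List A) → Unique (map f xs) →
  ∀ {a b} → f (List.lookup xs a) ≡ f (List.lookup xs b) → a ≡ b
Unique-map⇒lookup-injective f (x ∷ xs) _ {zero} {zero} _ = refl
Unique-map⇒lookup-injective f (x ∷ xs) (fx∉ ∷ _) {zero} {suc b} eq =
  contradiction eq (All.lookup fx∉ (∈-map⁺ f (∈-lookup b)))
Unique-map⇒lookup-injective f (x ∷ xs) (fx∉ ∷ _) {suc a} {zero} eq =
  contradiction (sym eq) (All.lookup fx∉ (∈-map⁺ f (∈-lookup a)))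
Unique-map⇒lookup-injective f (x ∷ xs) (_ ∷ unique) {suc a} {suc b} eq =
  cong suc (Unique-map⇒lookup-injective f xs unique eq)

length-cartesianProductWith : ∀ {A B C : Set} (f : A → B → C) xs ys →
  length (cartesianProductWith f xs ys) ≡ length xs * length ys
length-cartesianProductWith f []       ys = refl
length-cartesianProductWith f (x ∷ xs) ys = begin
  length (map (f x) ys ++ cartesianProductWith f xs ys)  ≡⟨ length-++ (map (f x) ys) ⟩
  length (map (f x) ys) + length (cartesianProductWith f xs ys)
    ≡⟨ cong₂ _+_ (length-map (f x) ys) (length-cartesianProductWith f xs ys) ⟩
  length ys + length xs * length ys                      ∎
  where open ≡-Reasoning

map-cartesianProductWith : ∀ {A B B′ C D : Set} (h : C → D) {f : A → B → C} {g : A → B′ → D}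
  {p : B → B′} → (∀ a b → h (f a b) ≡ g a (p b)) →
  ∀ xs ys → map h (cartesianProductWith f xs ys) ≡ cartesianProductWith g xs (map p ys)
map-cartesianProductWith h hf≡gp []       ys = refl
map-cartesianProductWith h {f} {g} {p} hf≡gp (x ∷ xs) ys = begin
  map h (map (f x) ys ++ cartesianProductWith f xs ys)
    ≡⟨ map-++ h (map (f x) ys) _ ⟩
  map h (map (f x) ys) ++ map h (cartesianProductWith f xs ys)
    ≡⟨ cong₂ _++_ (sym (map-∘ ys)) (map-cartesianProductWith h hf≡gp xs ys) ⟩
  map (h ∘ f x) ys ++ cartesianProductWith g xs (map p ys)
    ≡⟨ cong (_++ _) (trans (map-cong (hf≡gp x) ys) (map-∘ ys)) ⟩
  map (g x) (map p ys) ++ cartesianProductWith g xs (map p ys) ∎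
  where open ≡-Reasoning

Unique-∷-split : ∀ {A : Set} {k} {t : A} {as : List A} {xs ys : List (Vec A k)} → t ∉ as →
  Unique as → Unique xs → Unique ys → Unique (map (t ∷_) xs ++ cartesianProductWith _∷_ as ys)
Unique-∷-split {t = t} {as} {xs} {ys} t∉as as! xs! ys! =
  Unique.++⁺ (Unique.map⁺ ∷-injectiveʳ xs!) (Unique.cartesianProductWith⁺ _∷_ ∷-injective as! ys!)
    disjoint
  where
  disjoint : ∀ {v} → ¬ (v ∈ map (t ∷_) xs × v ∈ cartesianProductWith _∷_ as ys)
  disjoint (v∈xs , v∈prod) with ∈-map⁻ (t ∷_) v∈xs | ∈-cartesianProductWith⁻ _∷_ as ys v∈prod
  ... | _ , _ , refl | a , _ , a∈as , _ , eq = t∉as (subst (_∈ as) (sym (∷-injectiveˡ eq)) a∈as)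

remQuot-injective : ∀ {m} k {x y : Fin (m * k)} → remQuot {m} k x ≡ remQuot k y → x ≡ y
remQuot-injective {m} k {x} {y} eq =
  trans (sym (combine-remQuot {m} k x)) (trans (cong (uncurry combine) eq) (combine-remQuot {m} k y))

encode : ∀ {m n K} → Fin m × Vec (Fin n) K → Fin (m * n ^ K)
encode (c , v) = combine c (funToFin (lookup v))

encode-injective : ∀ {m n K} {x y : Fin m × Vec (Fin n) K} → encode x ≡ encode y → x ≡ y
encode-injective {x = c , v} {d , w} eq with combine-injective c _ d _ eq
... | refl , funs≡ = cong (c ,_) (lookup-ext v w λ i → begin
  lookup v i                          ≡⟨ finToFun-funToFin (lookup v) i ⟨
  finToFun (funToFin (lookup v)) i    ≡⟨ cong (λ z → finToFun z i) funs≡ ⟩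
  finToFun (funToFin (lookup w)) i    ≡⟨ finToFun-funToFin (lookup w) i ⟩
  lookup w i                          ∎)
  where open ≡-Reasoning

[1+a]^[1+p]≤a^[1+p]+[1+p]*[1+a]^p : ∀ a p → suc a ^ suc p ≤ a ^ suc p + suc p * suc a ^ p
[1+a]^[1+p]≤a^[1+p]+[1+p]*[1+a]^p a zero = ℕ.≤-reflexive (expand a)
  where
  expand : ∀ a → suc a * 1 ≡ a * 1 + 1 * 1
  expand = solve-∀
[1+a]^[1+p]≤a^[1+p]+[1+p]*[1+a]^p a (suc p) = begin
  suc a * suc a ^ suc p
    ≤⟨ ℕ.*-monoʳ-≤ (suc a) ([1+a]^[1+p]≤a^[1+p]+[1+p]*[1+a]^p a p) ⟩
  suc a * (a ^ suc p + suc p * suc a ^ p)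
    ≡⟨ expand a p (a ^ p) (suc a ^ p) ⟩
  a * (a * a ^ p) + suc p * (suc a * suc a ^ p) + a * a ^ p
    ≤⟨ ℕ.+-monoʳ-≤ (a * (a * a ^ p) + suc p * (suc a * suc a ^ p))
         (ℕ.^-monoˡ-≤ (suc p) (ℕ.n≤1+n a)) ⟩
  a * (a * a ^ p) + suc p * (suc a * suc a ^ p) + suc a * suc a ^ p
    ≡⟨ regroup a p (a ^ p) (suc a ^ p) ⟩
  a * (a * a ^ p) + (2 + p) * (suc a * suc a ^ p) ∎
  where
  open ℕ.≤-Reasoning
  expand : ∀ a p x y → suc a * (a * x + suc p * y) ≡ a * (a * x) + suc p * (suc a * y) + a * x
  expand = solve-∀
  regroup : ∀ a p x y →
    a * (a * x) + suc p * (suc a * y) + suc a * y ≡ a * (a * x) + (2 + p) * (suc a * y)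
  regroup = solve-∀

-- Peaks of a function Fin k → ℕ

module _ {k : ℕ} (f : Fin k → ℕ) where

  StrictMaxAt : Fin k → Set
  StrictMaxAt e = ∀ l → l ≢ e → f l ℕ.< f e

  PeakAt : ℕ → Fin k → Fin k → Set
  PeakAt m i j = f i ≡ m × f j ≡ m × (∀ l → l ≢ i → l ≢ j → f l ℕ.< m)

  OnePeakAt : ℕ → Fin k → Set
  OnePeakAt m t = f t ≡ m × (∀ l → l ≢ t → f l ℕ.< m)

  PeakAt-sym : ∀ {m i j} → PeakAt m i j → PeakAt m j i
  PeakAt-sym (fi , fj , below) = fj , fi , λ l l≢j l≢i → below l l≢i l≢j

  PeakAt⇒≤ : ∀ {m i j} → PeakAt m i j → ∀ l → f l ≤ m
  PeakAt⇒≤ {i = i} {j} (fi , fj , below) l with l Fin.≟ i | l Fin.≟ j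
  ... | yes refl | _        = ℕ.≤-reflexive fi
  ... | no _     | yes refl = ℕ.≤-reflexive fj
  ... | no l≢i   | no l≢j   = ℕ.<⇒≤ (below l l≢i l≢j)

  peak⇒¬strictMax : ∀ {m i j e} → i ≢ j → PeakAt m i j → ¬ StrictMaxAt e
  peak⇒¬strictMax {i = i} {j} {e} i≢j (fi , fj , below) max with e Fin.≟ i | e Fin.≟ j
  ... | yes refl | _        = ℕ.<-irrefl (trans fj (sym fi)) (max j (i≢j ∘ sym))
  ... | no e≢i   | yes refl = ℕ.<-irrefl (trans fi (sym fj)) (max i i≢j)
  ... | no e≢i   | no e≢j   =
    ℕ.<-asym (subst (ℕ._< f e) fi (max i (e≢i ∘ sym))) (below e e≢i e≢j)

  -- The strict maximum sits at c if f c > m and at d if f c < m.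
  breakPeak⇒strictMax : ∀ {m c d} → c ≢ d → f d ≡ m → f c ≢ m →
    (∀ l → l ≢ c → l ≢ d → f l ℕ.< m) → ∃ StrictMaxAt
  breakPeak⇒strictMax {m} {c} {d} c≢d fd fc≢m below with ℕ.<-cmp (f c) m
  ... | tri< fc<m _ _ = d , λ l l≢d → subst (f l ℕ.<_) (sym fd) (lower l l≢d)
    where
    lower : ∀ l → l ≢ d → f l ℕ.< m
    lower l l≢d with l Fin.≟ c
    ... | yes refl = fc<m
    ... | no l≢c   = below l l≢c l≢d
  ... | tri≈ _ fc≡m _ = contradiction fc≡m fc≢m
  ... | tri> _ _ fc>m = c , λ l l≢c → ℕ.≤-<-trans (atMost l l≢c) fc>m
    where
    atMost : ∀ l → l ≢ c → f l ≤ m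
    atMost l l≢c with l Fin.≟ d
    ... | yes refl = ℕ.≤-reflexive fd
    ... | no l≢d   = ℕ.<⇒≤ (below l l≢c l≢d)

values : ∀ {n k} → Point n k → Fin k → ℕ
values P = toℕ ∘ lookup P

Peaked : ∀ {n k} → ℕ → Rook n k → Set
Peaked m (P , ((i , j) , _)) = PeakAt (values P) m i j

attackedFromPeak⇒strictMax : ∀ {n k m c d} (P Q : Point n k) → c ≢ d →
  PeakAt (values P) m c d → lookup P c ≢ lookup Q c →
  (∀ l → l ≢ c → lookup P l ≡ lookup Q l) → ∃ (StrictMaxAt (values Q))
attackedFromPeak⇒strictMax {d = d} P Q c≢d (Pc , Pd , below) Pc≢Qc agree =
  breakPeak⇒strictMax _ c≢d
    (trans (cong toℕ (sym (agree d (c≢d ∘ sym)))) Pd)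
    (λ Qc → Pc≢Qc (toℕ-injective (trans Pc (sym Qc))))
    (λ l l≢c l≢d → subst (ℕ._< _) (cong toℕ (agree l l≢c)) (below l l≢c l≢d))

peaked⇒¬attacks : ∀ {n k m m′} (r r′ : Rook n k) → Peaked m r → Peaked m′ r′ →
  ¬ Attacks r (pos r′)
peaked⇒¬attacks (P , ((i , j) , i<j)) (Q , ((i′ , j′) , i′<j′)) peak peak′
                (c , inj₁ refl , Pc≢Qc , agree) =
  peak⇒¬strictMax (values Q) (Fin.<⇒≢ i′<j′) peak′
    (proj₂ (attackedFromPeak⇒strictMax P Q (Fin.<⇒≢ i<j) peak Pc≢Qc agree))
peaked⇒¬attacks (P , ((i , j) , i<j)) (Q , ((i′ , j′) , i′<j′)) peak peak′
                (c , inj₂ refl , Pc≢Qc , agree) =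
  peak⇒¬strictMax (values Q) (Fin.<⇒≢ i′<j′) peak′
    (proj₂ (attackedFromPeak⇒strictMax P Q (Fin.<⇒≢ i<j ∘ sym) (PeakAt-sym _ peak) Pc≢Qc agree))

peaked⇒valid : ∀ {n k} (rs : List (Rook n k)) → Unique (map pos rs) →
  All (λ r → ∃ λ m → Peaked m r) rs → Valid rs
peaked⇒valid rs unique peaked a b a≢b =
  a≢b ∘ Unique-map⇒lookup-injective pos rs unique ,
  peaked⇒¬attacks (List.lookup rs a) (List.lookup rs b)
    (proj₂ (All.lookup peaked (∈-lookup a))) (proj₂ (All.lookup peaked (∈-lookup b)))

-- Upper bound

direction : ∀ {k} → TwoSet k → Fin 2 → Fin k
direction ((i , j) , _) zero       = i
direction ((i , j) , _) (suc zero) = j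

direction∈D : ∀ {k} (D : TwoSet k) s → direction D s ∈D D
direction∈D D zero       = inj₁ refl
direction∈D D (suc zero) = inj₂ refl

direction-injective : ∀ {k} (D : TwoSet k) {s t} → direction D s ≡ direction D t → s ≡ t
direction-injective D {zero}     {zero}     _  = refl
direction-injective D {zero}     {suc zero} eq = contradiction eq (Fin.<⇒≢ (proj₂ D))
direction-injective D {suc zero} {zero}     eq = contradiction (sym eq) (Fin.<⇒≢ (proj₂ D))
direction-injective D {suc zero} {suc zero} _  = refl

-- A line of H_{n,k} is given by its axis and the coordinates off that axis.
line : ∀ {n K} → Rook n (suc K) → Fin 2 → Fin (suc K) × Point n K
line (P , D) s = direction D s , removeAt P (direction D s)

sameLine⇒attacks : ∀ {n K} (P Q : Point n (suc K)) {D c} → c ∈D D →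
  removeAt P c ≡ removeAt Q c → P ≢ Q → Attacks (P , D) Q
sameLine⇒attacks P Q {c = c} c∈D eq P≢Q = c , c∈D , Pc≢Qc , agree
  where
  agree : ∀ l → l ≢ c → lookup P l ≡ lookup Q l
  agree = removeAt-≡⇒lookup-≡ P Q eq
  Pc≢Qc : lookup P c ≢ lookup Q c
  Pc≢Qc Pc≡Qc = P≢Q (lookup-ext P Q λ l → case l Fin.≟ c of λ
    { (yes refl) → Pc≡Qc
    ; (no l≢c)   → agree l l≢c })

valid⇒lines-injective : ∀ {n K} (rs : List (Rook n (suc K))) → Valid rs →
  ∀ {a b s t} → line (List.lookup rs a) s ≡ line (List.lookup rs b) t → (a , s) ≡ (b , t)
valid⇒lines-injective {n} {K} rs valid {a} {b} {s} eq with a Fin.≟ b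
... | yes refl = cong (a ,_) (direction-injective (proj₂ (List.lookup rs a)) (,-injectiveˡ eq))
... | no a≢b   = contradiction attack (proj₂ (valid a b a≢b))
  where
  P Q : Point n (suc K)
  P = proj₁ (List.lookup rs a)
  Q = proj₁ (List.lookup rs b)
  D : TwoSet (suc K)
  D = proj₂ (List.lookup rs a)
  attack : Attacks (List.lookup rs a) Q
  attack = sameLine⇒attacks P Q {D} {direction D s} (direction∈D D s)
    (trans (,-injectiveʳ eq) (cong (removeAt Q) (sym (,-injectiveˡ eq))))
    (proj₁ (valid a b a≢b))

valid⇒length*2≤lines : ∀ {n K} (rs : List (Rook n (suc K))) → Valid rs →
  length rs * 2 ≤ suc K * n ^ K
valid⇒length*2≤lines {n} {K} rs valid =
  injective⇒≤ {f = encode ∘ uncurry lineOf ∘ remQuot {length rs} 2}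
  (remQuot-injective {length rs} 2 ∘ valid⇒lines-injective rs valid ∘ encode-injective)
  where
  lineOf : Fin (length rs) → Fin 2 → Fin (suc K) × Point n K
  lineOf = line ∘ List.lookup rs

-- Lower bound

shift : ∀ {k} → TwoSet k → TwoSet (suc k)
shift ((i , j) , i<j) = (suc i , suc j) , s<s i<j

-- Points of level m: all coordinates are at most m, with the value m
-- attained at no, one or two prescribed coordinates.
module Level {n m : ℕ} (m<n : m ℕ.< n) where

  top : Fin n
  top = Fin.fromℕ< m<n

  lower : List (Fin n)
  lower = map (λ i → Fin.inject≤ i (ℕ.<⇒≤ m<n)) (allFin m)

  lower-< : ∀ {a} → a ∈ lower → toℕ a ℕ.< m
  lower-< a∈ with ∈-map⁻ _ a∈
  ... | i , _ , refl = subst (ℕ._< m) (sym (toℕ-inject≤ i _)) (toℕ<n i)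

  top∉lower : top ∉ lower
  top∉lower top∈ = ℕ.<-irrefl (toℕ-fromℕ< m<n) (lower-< top∈)

  lower-unique : Unique lower
  lower-unique = Unique.map⁺ (inject≤-injective _ _ _ _) (Unique.allFin⁺ m)

  length-lower : length lower ≡ m
  length-lower = trans (length-map _ (allFin m)) (length-tabulate _)

  pointsBelow : ∀ k → List (Point n k)
  pointsBelow zero    = [] ∷ []
  pointsBelow (suc k) = cartesianProductWith _∷_ lower (pointsBelow k)

  topAtHead : ∀ {k} → Point n k → Point n (suc k) × Fin (suc k)
  topAtHead P = top ∷ P , zero

  consOnePeak : ∀ {k} → Fin n → Point n k × Fin k → Point n (suc k) × Fin (suc k)
  consOnePeak a (P , t) = a ∷ P , suc t

  pointsWithOnePeak : ∀ k → List (Point n k × Fin k)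
  pointsWithOnePeak zero    = []
  pointsWithOnePeak (suc k) =
    map topAtHead (pointsBelow k) ++ cartesianProductWith consOnePeak lower (pointsWithOnePeak k)

  secondTopAtHead : ∀ {k} → Point n k × Fin k → Rook n (suc k)
  secondTopAtHead (P , t) = top ∷ P , (zero , suc t) , z<s

  consRook : ∀ {k} → Fin n → Rook n k → Rook n (suc k)
  consRook a (P , D) = a ∷ P , shift D

  peakedRooks : ∀ k → List (Rook n k)
  peakedRooks zero    = []
  peakedRooks (suc k) =
    map secondTopAtHead (pointsWithOnePeak k) ++ cartesianProductWith consRook lower (peakedRooks k)

  ∈pointsBelow⇒< : ∀ k {P} → P ∈ pointsBelow k → ∀ l → toℕ (lookup P l) ℕ.< m
  ∈pointsBelow⇒< (suc k) P∈ l with ∈-cartesianProductWith⁻ _∷_ lower (pointsBelow k) P∈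
  ∈pointsBelow⇒< (suc k) P∈ zero    | a , _ , a∈ , _  , refl = lower-< a∈
  ∈pointsBelow⇒< (suc k) P∈ (suc l) | _ , _ , _  , P∈′ , refl = ∈pointsBelow⇒< k P∈′ l

  ∈pointsWithOnePeak⇒onePeak : ∀ k {x} → x ∈ pointsWithOnePeak k →
    OnePeakAt (values (proj₁ x)) m (proj₂ x)
  ∈pointsWithOnePeak⇒onePeak (suc k) x∈ with ∈-++⁻ (map topAtHead (pointsBelow k)) x∈
  ... | inj₁ x∈ˡ with ∈-map⁻ _ x∈ˡ
  ...   | P , P∈ , refl = toℕ-fromℕ< m<n , λ
    { zero 0≢0 → contradiction refl 0≢0
    ; (suc l) _ → ∈pointsBelow⇒< k P∈ l }
  ∈pointsWithOnePeak⇒onePeak (suc k) x∈ | inj₂ x∈ʳ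
    with ∈-cartesianProductWith⁻ _ lower (pointsWithOnePeak k) x∈ʳ
  ... | a , _ , a∈ , x∈′ , refl with ∈pointsWithOnePeak⇒onePeak k x∈′
  ...   | Pt≡m , below = Pt≡m , λ
    { zero _      → lower-< a∈
    ; (suc l) l≢t → below l (l≢t ∘ cong suc) }

  ∈peakedRooks⇒peaked : ∀ k {r} → r ∈ peakedRooks k → Peaked m r
  ∈peakedRooks⇒peaked (suc k) r∈ with ∈-++⁻ (map secondTopAtHead (pointsWithOnePeak k)) r∈
  ... | inj₁ r∈ˡ with ∈-map⁻ _ r∈ˡ
  ...   | _ , x∈ , refl with ∈pointsWithOnePeak⇒onePeak k x∈
  ...     | Pt≡m , below = toℕ-fromℕ< m<n , Pt≡m , λ
    { zero 0≢0 _     → contradiction refl 0≢0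
    ; (suc l) _ l≢t → below l (l≢t ∘ cong suc) }
  ∈peakedRooks⇒peaked (suc k) r∈ | inj₂ r∈ʳ
    with ∈-cartesianProductWith⁻ _ lower (peakedRooks k) r∈ʳ
  ... | a , _ , a∈ , r∈′ , refl with ∈peakedRooks⇒peaked k r∈′
  ...   | Pi≡m , Pj≡m , below = Pi≡m , Pj≡m , λ
    { zero _ _          → lower-< a∈
    ; (suc l) l≢i l≢j → below l (l≢i ∘ cong suc) (l≢j ∘ cong suc) }

  unique-positions : ∀ {k} {X Y Z : Set} (position : Z → Point n (suc k))
    {f : X → Z} {px : X → Point n k} {g : Fin n → Y → Z} {py : Y → Point n k} →
    (∀ x → position (f x) ≡ top ∷ px x) → (∀ a y → position (g a y) ≡ a ∷ py y) →
    ∀ xs ys → Unique (map px xs) → Unique (map py ys) →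
    Unique (map position (map f xs ++ cartesianProductWith g lower ys))
  unique-positions position {f} {px} {g} {py} position-f position-g xs ys xs! ys! =
    subst Unique (sym positions) (Unique-∷-split top∉lower lower-unique xs! ys!)
    where
    positions : map position (map f xs ++ cartesianProductWith g lower ys)
              ≡ map (top ∷_) (map px xs) ++ cartesianProductWith _∷_ lower (map py ys)
    positions = trans (map-++ position (map f xs) _) (cong₂ _++_
      (trans (sym (map-∘ xs)) (trans (map-cong position-f xs) (map-∘ xs)))
      (map-cartesianProductWith position position-g lower ys))

  pointsBelow-unique : ∀ k → Unique (pointsBelow k)
  pointsBelow-unique zero    = All.[] ∷ []
  pointsBelow-unique (suc k) =
    Unique.cartesianProductWith⁺ _∷_ ∷-injective lower-unique (pointsBelow-unique k)

  pointsWithOnePeak-unique : ∀ k → Unique (map proj₁ (pointsWithOnePeak k))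
  pointsWithOnePeak-unique zero    = []
  pointsWithOnePeak-unique (suc k) =
    unique-positions proj₁ (λ _ → refl) (λ _ _ → refl) (pointsBelow k) (pointsWithOnePeak k)
      (subst Unique (sym (map-id _)) (pointsBelow-unique k)) (pointsWithOnePeak-unique k)

  peakedRooks-unique : ∀ k → Unique (map pos (peakedRooks k))
  peakedRooks-unique zero    = []
  peakedRooks-unique (suc k) =
    unique-positions pos (λ _ → refl) (λ _ _ → refl) (pointsWithOnePeak k) (peakedRooks k)
      (pointsWithOnePeak-unique k) (peakedRooks-unique k)

  length-split : ∀ {X Y Z : Set} (f : X → Z) (g : Fin n → Y → Z) xs ys →
    length (map f xs ++ cartesianProductWith g lower ys) ≡ length xs + m * length ys
  length-split f g xs ys = begin
    length (map f xs ++ cartesianProductWith g lower ys)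
      ≡⟨ length-++ (map f xs) ⟩
    length (map f xs) + length (cartesianProductWith g lower ys)
      ≡⟨ cong₂ _+_ (length-map f xs) (length-cartesianProductWith g lower ys) ⟩
    length xs + length lower * length ys
      ≡⟨ cong (λ l → length xs + l * length ys) length-lower ⟩
    length xs + m * length ys ∎
    where open ≡-Reasoning

  length-pointsBelow : ∀ k → length (pointsBelow k) ≡ m ^ k
  length-pointsBelow zero    = refl
  length-pointsBelow (suc k) = trans (length-cartesianProductWith _∷_ lower (pointsBelow k))
    (cong₂ _*_ length-lower (length-pointsBelow k))

  length-pointsWithOnePeak : ∀ k → length (pointsWithOnePeak (suc k)) ≡ suc k * m ^ k
  length-pointsWithOnePeak zero = trans (length-split topAtHead consOnePeak (pointsBelow 0) [])
    (cong suc (ℕ.*-zeroʳ m))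
  length-pointsWithOnePeak (suc k) = begin
    length (pointsWithOnePeak (2 + k))
      ≡⟨ length-split topAtHead consOnePeak (pointsBelow (suc k)) (pointsWithOnePeak (suc k)) ⟩
    length (pointsBelow (suc k)) + m * length (pointsWithOnePeak (suc k))
      ≡⟨ cong₂ (λ x y → x + m * y) (length-pointsBelow (suc k)) (length-pointsWithOnePeak k) ⟩
    m * m ^ k + m * (suc k * m ^ k)
      ≡⟨ collect m k (m ^ k) ⟩
    (2 + k) * (m * m ^ k) ∎
    where
    open ≡-Reasoning
    collect : ∀ m k x → m * x + m * (suc k * x) ≡ (2 + k) * (m * x)
    collect = solve-∀

  length-peakedRooks : ∀ k → 2 * length (peakedRooks (2 + k)) ≡ (2 + k) * suc k * m ^ k
  length-peakedRooks zero = begin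
    2 * length (peakedRooks 2)
      ≡⟨ cong (2 *_) (length-split secondTopAtHead consRook (pointsWithOnePeak 1) (peakedRooks 1)) ⟩
    2 * (length (pointsWithOnePeak 1) + m * length (peakedRooks 1))
      ≡⟨ cong₂ (λ x y → 2 * (x + m * y)) (length-pointsWithOnePeak 0)
           (trans (length-split secondTopAtHead consRook [] []) (ℕ.*-zeroʳ m)) ⟩
    2 * (1 * 1 + m * 0)
      ≡⟨ cong (λ x → 2 * (1 + x)) (ℕ.*-zeroʳ m) ⟩
    2 * 1 * 1 ∎
    where open ≡-Reasoning
  length-peakedRooks (suc k) = begin
    2 * length (peakedRooks (3 + k))
      ≡⟨ cong (2 *_) (length-split secondTopAtHead consRook (pointsWithOnePeak (2 + k)) _) ⟩
    2 * (length (pointsWithOnePeak (2 + k)) + m * length (peakedRooks (2 + k)))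
      ≡⟨ distribute (length (pointsWithOnePeak (2 + k))) m (length (peakedRooks (2 + k))) ⟩
    2 * length (pointsWithOnePeak (2 + k)) + m * (2 * length (peakedRooks (2 + k)))
      ≡⟨ cong₂ (λ x y → 2 * x + m * y) (length-pointsWithOnePeak (suc k)) (length-peakedRooks k) ⟩
    2 * ((2 + k) * (m * m ^ k)) + m * ((2 + k) * suc k * m ^ k)
      ≡⟨ collect m k (m ^ k) ⟩
    (3 + k) * (2 + k) * (m * m ^ k) ∎
    where
    open ≡-Reasoning
    distribute : ∀ x m y → 2 * (x + m * y) ≡ 2 * x + m * (2 * y)
    distribute = solve-∀
    collect : ∀ m k x →
      2 * ((2 + k) * (m * x)) + m * ((2 + k) * suc k * x) ≡ (3 + k) * (2 + k) * (m * x)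
    collect = solve-∀

placement : ∀ {n} K m → m ≤ n → List (Rook n (2 + K))
placement K zero    _   = []
placement K (suc m) m<n = placement K m (ℕ.<⇒≤ m<n) ++ Level.peakedRooks m<n (2 + K)

∈placement⇒peaked : ∀ {n} K m (m≤n : m ≤ n) {r} → r ∈ placement K m m≤n →
  ∃ λ l → l ℕ.< m × Peaked l r
∈placement⇒peaked K (suc m) m<n r∈ with ∈-++⁻ (placement K m (ℕ.<⇒≤ m<n)) r∈
... | inj₁ r∈ˡ = let l , l<m , peak = ∈placement⇒peaked K m (ℕ.<⇒≤ m<n) r∈ˡ
                 in l , ℕ.m<n⇒m<1+n l<m , peak
... | inj₂ r∈ʳ = m , ℕ.n<1+n m , Level.∈peakedRooks⇒peaked m<n (2 + K) r∈ʳ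

placement-unique : ∀ {n} K m (m≤n : m ≤ n) → Unique (map pos (placement K m m≤n))
placement-unique K zero    _   = []
placement-unique K (suc m) m<n = subst Unique (sym (map-++ pos (placement K m _) _))
  (Unique.++⁺ (placement-unique K m _) (Level.peakedRooks-unique m<n (2 + K)) disjoint)
  where
  disjoint : ∀ {P} → ¬ (P ∈ map pos (placement K m _) × P ∈ map pos (Level.peakedRooks m<n (2 + K)))
  disjoint (P∈ˡ , P∈ʳ) with ∈-map⁻ pos P∈ˡ | ∈-map⁻ pos P∈ʳ
  ... | r , r∈ , refl | (_ , ((i , _) , _)) , r′∈ , refl
    with ∈placement⇒peaked K m _ r∈ | Level.∈peakedRooks⇒peaked m<n (2 + K) r′∈
  ... | l , l<m , peak | Pi≡m , _ =
    ℕ.<-irrefl refl (ℕ.≤-<-trans (subst (_≤ l) Pi≡m (PeakAt⇒≤ _ peak i)) l<m)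

placement-valid : ∀ n K → Valid (placement {n} K n ℕ.≤-refl)
placement-valid n K = peaked⇒valid _ (placement-unique K n ℕ.≤-refl)
  (All.tabulate λ r∈ → let l , _ , peak = ∈placement⇒peaked K n ℕ.≤-refl r∈ in l , peak)

placement-size : ∀ {n} K m (m≤n : m ≤ n) →
  (2 + K) * m ^ suc K ≤ 2 * length (placement K m m≤n) + (2 + K) * suc K * m ^ K
placement-size K zero    _   = ℕ.≤-trans (ℕ.≤-reflexive (ℕ.*-zeroʳ (2 + K))) z≤n
placement-size {n} K (suc m) m<n = begin
  k * suc m ^ suc K
    ≤⟨ ℕ.*-monoʳ-≤ k ([1+a]^[1+p]≤a^[1+p]+[1+p]*[1+a]^p m K) ⟩
  k * (m ^ suc K + suc K * suc m ^ K)
    ≡⟨ ℕ.*-distribˡ-+ k (m ^ suc K) _ ⟩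
  k * m ^ suc K + k * (suc K * suc m ^ K)
    ≤⟨ ℕ.+-mono-≤ (placement-size K m _) (ℕ.≤-reflexive (sym (ℕ.*-assoc k (suc K) _))) ⟩
  2 * length before + k * suc K * m ^ K + k * suc K * suc m ^ K
    ≡⟨ cong (λ x → 2 * length before + x + k * suc K * suc m ^ K)
         (sym (Level.length-peakedRooks m<n K)) ⟩
  2 * length before + 2 * length level + k * suc K * suc m ^ K
    ≡⟨ cong (_+ k * suc K * suc m ^ K) (sym (ℕ.*-distribˡ-+ 2 (length before) _)) ⟩
  2 * (length before + length level) + k * suc K * suc m ^ K
    ≡⟨ cong (λ x → 2 * x + k * suc K * suc m ^ K) (sym (length-++ before)) ⟩
  2 * length (before ++ level) + k * suc K * suc m ^ K ∎
  where
  open ℕ.≤-Reasoning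
  k : ℕ
  k = 2 + K
  before level : List (Rook n k)
  before = placement K m (ℕ.<⇒≤ m<n)
  level = Level.peakedRooks m<n k

-- The limit

toℚᵘ-/ : ∀ a d .{{_ : ℕ.NonZero d}} → toℚᵘ ((+ a) / d) ≃ mkℚᵘ (+ a) (ℕ.pred d)
toℚᵘ-/ a (suc d) = ℚ.toℚᵘ-fromℚᵘ (mkℚᵘ (+ a) d)

∣⊖∣-numerator : ∀ b c N e → b * e ≤ c * N →
  ℤ.∣ + b ℤ.* + e ℤ.+ ℤ.- (+ c) ℤ.* + N ∣ ≡ c * N ∸ b * e
∣⊖∣-numerator b c N e be≤cN = begin
  ℤ.∣ + b ℤ.* + e ℤ.+ ℤ.- (+ c) ℤ.* + N ∣
    ≡⟨ cong ℤ.∣_∣ (cong₂ ℤ._+_ (sym (ℤ.pos-* b e))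
         (trans (sym (ℤ.neg-distribˡ-* (+ c) (+ N))) (cong ℤ.-_ (sym (ℤ.pos-* c N))))) ⟩
  ℤ.∣ + (b * e) ℤ.+ ℤ.- + (c * N) ∣
    ≡⟨ cong ℤ.∣_∣ (ℤ.m-n≡m⊖n (b * e) (c * N)) ⟩
  ℤ.∣ (b * e) ⊖ (c * N) ∣
    ≡⟨ ℤ.∣⊖∣-≤ be≤cN ⟩
  c * N ∸ b * e ∎
  where open ≡-Reasoning

-- The hypothesis bounds the distance by 1/↧ε ≤ ε; on unnormalised rationals the
-- comparison is a cross-multiplication of naturals.
∣b/N-c/e∣<ε : ∀ b c N e .{{_ : ℕ.NonZero N}} .{{_ : ℕ.NonZero e}} (ε : ℚ) → 0ℚ < ε →
  b * e ≤ c * N → (c * N ∸ b * e) * ↧ₙ ε ℕ.< N * e →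
  ∣ (+ b) / N - (+ c) / e ∣ < ε
∣b/N-c/e∣<ε b c N@(suc N-1) e@(suc e-1) (mkℚ (+ suc p) d-1 _) _ be≤cN close =
  ℚ.toℚᵘ-cancel-< (ℚᵘ.<-respˡ-≃ (ℚᵘ.≃-sym toUnnormalised) (ℚᵘ.*<* (subst₂ ℤ._<_
    (trans (ℤ.pos-* (c * N ∸ b * e) (suc d-1))
      (cong (λ x → + x ℤ.* + suc d-1) (sym (∣⊖∣-numerator b c N e be≤cN))))
    (ℤ.pos-* (suc p) (N * e))
    (+<+ (ℕ.<-≤-trans close (ℕ.m≤n*m (N * e) (suc p)))))))
  where
  X : ℚ
  X = (+ b) / N - (+ c) / e
  toUnnormalised : toℚᵘ ∣ X ∣ ≃ ℚᵘ.∣ mkℚᵘ (+ b) N-1 ℚᵘ.- mkℚᵘ (+ c) e-1 ∣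
  toUnnormalised = ℚᵘ.≃-trans (ℚ.toℚᵘ-homo-∣-∣ X) (ℚᵘ.∣-∣-cong (ℚᵘ.≃-trans
    (ℚ.toℚᵘ-homo-+ ((+ b) / N) (Data.Rational.- ((+ c) / e)))
    (ℚᵘ.+-cong (toℚᵘ-/ b N) (ℚᵘ.≃-trans (ℚ.toℚᵘ-homo‿- ((+ c) / e)) (ℚᵘ.-‿cong (toℚᵘ-/ c e))))))
∣b/N-c/e∣<ε b c (suc _) (suc _) (mkℚ (+ zero) _ _) (*<* (+<+ ()))
∣b/N-c/e∣<ε b c (suc _) (suc _) (mkℚ ℤ.-[1+ _ ] _ _) (*<* ())

IsMaxRooks⇒bounds : ∀ n K b → IsMaxRooks n (2 + K) b →
  b * 2 ≤ (2 + K) * n ^ suc K × (2 + K) * n ^ suc K ≤ b * 2 + (2 + K) * suc K * n ^ K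
IsMaxRooks⇒bounds n K b ((rs , valid , refl) , maximal) =
  valid⇒length*2≤lines rs valid ,
  ℕ.≤-trans (placement-size K n ℕ.≤-refl) (ℕ.+-monoˡ-≤ _ (begin
    2 * length (placement K n ℕ.≤-refl)
      ≤⟨ ℕ.*-monoʳ-≤ 2 (maximal (placement K n ℕ.≤-refl) (placement-valid n K)) ⟩
    2 * length rs
      ≡⟨ ℕ.*-comm 2 (length rs) ⟩
    length rs * 2 ∎))
  where open ℕ.≤-Reasoning

bounds⇒∣ratio-k/2∣< : ∀ K b n' (ε : ℚ) → 0ℚ < ε →
  let k = 2 + K; n = suc n'; C = k * suc K in
  b * 2 ≤ k * n ^ suc K → k * n ^ suc K ≤ b * 2 + C * n ^ K → C * ↧ₙ ε ≤ n →
  ∣ ratio b n' k - (+ k) / 2 ∣ < ε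
bounds⇒∣ratio-k/2∣< K b n' ε 0<ε upper lower C*den≤n =
  ∣b/N-c/e∣<ε b k N 2 {{ℕ.m^n≢0 n (suc K)}} ε 0<ε upper (begin-strict
    (k * N ∸ b * 2) * ↧ₙ ε  ≤⟨ ℕ.*-monoˡ-≤ (↧ₙ ε) (ℕ.m≤n+o⇒m∸n≤o (k * N) (b * 2) lower) ⟩
    C * M * ↧ₙ ε            ≡⟨ swap C M (↧ₙ ε) ⟩
    C * ↧ₙ ε * M            ≤⟨ ℕ.*-monoˡ-≤ M C*den≤n ⟩
    N                       <⟨ ℕ.m<m*n N 2 {{ℕ.m^n≢0 n (suc K)}} (s≤s (s≤s z≤n)) ⟩
    N * 2                   ∎)
  where
  open ℕ.≤-Reasoning
  k n C N M : ℕ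
  k = 2 + K
  n = suc n'
  C = k * suc K
  N = n ^ suc K
  M = n ^ K
  swap : ∀ c m d → c * m * d ≡ c * d * m
  swap = solve-∀

theorem20 : ∀ (k : ℕ) → 2 ≤ k → (b : ℕ → ℕ) → (∀ n → IsMaxRooks n k (b n)) →
    ∀ (ε : ℚ) → 0ℚ < ε → ∃ λ (N : ℕ) → ∀ (n' : ℕ) → N ≤ suc n' →
      ∣ ratio (b (suc n')) n' k - (+ k) / 2 ∣ < ε
theorem20 (suc (suc K)) (s≤s (s≤s z≤n)) b isMax ε 0<ε =
  (2 + K) * suc K * ↧ₙ ε , λ n' C*den≤n →
    let upper , lower = IsMaxRooks⇒bounds (suc n') K (b (suc n')) (isMax (suc n'))
    in bounds⇒∣ratio-k/2∣< K (b (suc n')) n' ε 0<ε upper lower C*den≤n
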